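{- Let $(W,B)$ be a spherical latin bitrade and let $(r_0,c_0,s_0)$, $(r_1,c_1,s_1)$ be two triples of $W$. Let $\mathcal{A}^*$ be the group defined using $(r_0,c_0,s_0)$ and $\mathcal{A}^\#$ the group defined using $(r_1,c_1,s_1)$ as in the context. Then there is an isomorphism $\mathcal{A}^\#\to\mathcal{A}^*$ which maps the image of $r-r'$ in $\mathcal{A}^\#$ to the image of $r-r'$ in $\mathcal{A}^*$ for all rows $r,r'\in R$.
   Context: A latin bitrade is a pair $(W,B)$ of non-empty finite sets of triples (row, column, symbol), any two distinct triples in the same set agreeing in at most one coordinate, such that for each $(r,c,s)\in W$ (resp. $B$) there exist unique $r'\ne r$, $c'\ne c$, $s'\ne s$ with $(r',c,s),(r,c',s),(r,c,s')\in B$ (resp. $W$). It is connected if it is not the union of two latin bitrades $(W',B')$, $(W'',B'')$ with $W'\cap W''=\emptyset$. With $R,C,S$ the pairwise disjoint sets of rows, columns, symbols used: for each row $r$ let $\psi_r(s)=s'$ iff $(r,c,s)\in W$, $(r,c,s')\in B$ for some $c$, with analogous permutations for columns and symbols; the bitrade is separated if all are single cycles. It is spherical if separated, connected and $2+|W|-|R|-|C|-|S|=0$. Let $\mathcal{V}=R\cup C\cup S$ be commuting indeterminates. For a chosen triple $(a,b,d)\in W$, the associated group is the abelian group $\langle \mathcal{V}\mid r+c+s=0 \text{ for all }(r,c,s)\in W;\ a=b=d=0\rangle$. -}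

module Defs where

open import Data.Nat as ℕ using (ℕ; suc; _+_)
open import Data.Integer as ℤ using (ℤ; +_; -[1+_])
open import Data.Product using (Σ; ∃; _×_; _,_; proj₁; proj₂)
open import Data.Product.Properties using (≡-dec)
open import Data.List using (List; []; _∷_; _++_; map; concatMap; length; deduplicate)
open import Data.List.Membership.Propositional using (_∈_; _∉_)
open import Data.List.Relation.Unary.All as All using (All; []; _∷_)
open import Data.List.Relation.Unary.All.Properties using (++⁺)
open import Relation.Binary.PropositionalEquality using (_≡_; _≢_; refl; cong)
open import Relation.Binary.Construct.Closure.ReflexiveTransitive using (Star)
open import Relation.Nullary using (¬_; Dec; yes; no)

-- Triples (row, column, symbol).  Rows, columns and symbols are each
-- labelled by natural numbers; they are kept pairwise disjoint by the
-- coordinate position (tagging), see 'Var' below.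

Triple : Set
Triple = ℕ × ℕ × ℕ

_≟T_ : (t u : Triple) → Dec (t ≡ u)
_≟T_ = ≡-dec ℕ._≟_ (≡-dec ℕ._≟_ ℕ._≟_)

-- finite sets are represented by lists (membership = set membership)
SameSet : List Triple → List Triple → Set
SameSet X Y = ∀ t → (t ∈ X → t ∈ Y) × (t ∈ Y → t ∈ X)

card : List ℕ → ℕ
card xs = length (deduplicate ℕ._≟_ xs)

cardT : List Triple → ℕ
cardT xs = length (deduplicate _≟T_ xs)

data NonEmpty {A : Set} : List A → Set where
  nonEmpty : ∀ x xs → NonEmpty (x ∷ xs)

PartialLatin : List Triple → Set
PartialLatin T = ∀ r c s r' c' s' → (r , c , s) ∈ T → (r' , c' , s') ∈ T →
  (r , c , s) ≢ (r' , c' , s') →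
  ¬ (r ≡ r' × c ≡ c') × ¬ (r ≡ r' × s ≡ s') × ¬ (c ≡ c' × s ≡ s')

ExactlyOne : (ℕ → Set) → Set
ExactlyOne P = Σ ℕ λ x → P x × (∀ y → P y → y ≡ x)

Mates : List Triple → List Triple → Set
Mates T U = ∀ r c s → (r , c , s) ∈ T →
  ExactlyOne (λ r' → r' ≢ r × (r' , c , s) ∈ U) ×
  ExactlyOne (λ c' → c' ≢ c × (r , c' , s) ∈ U) ×
  ExactlyOne (λ s' → s' ≢ s × (r , c , s') ∈ U)

IsBitrade : List Triple → List Triple → Set
IsBitrade W B = NonEmpty W × NonEmpty B × PartialLatin W × PartialLatin B ×
  Mates W B × Mates B W

Connected : List Triple → List Triple → Set
Connected W B = ¬ (Σ (List Triple) λ W' → Σ (List Triple) λ B' →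
  Σ (List Triple) λ W'' → Σ (List Triple) λ B'' →
  IsBitrade W' B' × IsBitrade W'' B'' ×
  (∀ t → t ∈ W' → t ∉ W'') ×
  SameSet W (W' ++ W'') × SameSet B (B' ++ B''))

rowsOf colsOf symsOf : List Triple → List ℕ
rowsOf = map proj₁
colsOf = map (λ t → proj₁ (proj₂ t))
symsOf = map (λ t → proj₂ (proj₂ t))

RowPerm : List Triple → List Triple → ℕ → ℕ → ℕ → Set
RowPerm W B r s s' = ∃ λ c → (r , c , s) ∈ W × (r , c , s') ∈ B
RowDom : List Triple → ℕ → ℕ → Set
RowDom W r s = ∃ λ c → (r , c , s) ∈ W

ColPerm : List Triple → List Triple → ℕ → ℕ → ℕ → Set
ColPerm W B c r r' = ∃ λ s → (r , c , s) ∈ W × (r' , c , s) ∈ B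
ColDom : List Triple → ℕ → ℕ → Set
ColDom W c r = ∃ λ s → (r , c , s) ∈ W

SymPerm : List Triple → List Triple → ℕ → ℕ → ℕ → Set
SymPerm W B s c c' = ∃ λ r → (r , c , s) ∈ W × (r , c' , s) ∈ B
SymDom : List Triple → ℕ → ℕ → Set
SymDom W s c = ∃ λ r → (r , c , s) ∈ W

-- a permutation (given as a relation) on domain D is a single cycle iff
-- every element of D reaches every other element by iteration
SingleCycle : (ℕ → Set) → (ℕ → ℕ → Set) → Set
SingleCycle D P = ∀ x y → D x → D y → Star P x y

Separated : List Triple → List Triple → Set
Separated W B =
  (∀ r → SingleCycle (RowDom W r) (RowPerm W B r)) ×
  (∀ c → SingleCycle (ColDom W c) (ColPerm W B c)) ×
  (∀ s → SingleCycle (SymDom W s) (SymPerm W B s))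

Spherical : List Triple → List Triple → Set
Spherical W B = Separated W B × Connected W B ×
  (2 + cardT W ≡ card (rowsOf W) + card (colsOf W) + card (symsOf W))

-- The associated abelian group, as a presentation:
-- formal ℤ-linear combinations of the indeterminates in V = R ∪ C ∪ S,
-- modulo the subgroup generated by the relators.

data Var : Set where
  rv cv sv : ℕ → Var

_≟V_ : (u v : Var) → Dec (u ≡ v)
rv x ≟V rv y with x ℕ.≟ y
... | yes refl = yes refl
... | no p = no λ { refl → p refl }
cv x ≟V cv y with x ℕ.≟ y
... | yes refl = yes refl
... | no p = no λ { refl → p refl }
sv x ≟V sv y with x ℕ.≟ y
... | yes refl = yes refl
... | no p = no λ { refl → p refl }
rv _ ≟V cv _ = no λ ()
rv _ ≟V sv _ = no λ ()
cv _ ≟V rv _ = no λ ()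
cv _ ≟V sv _ = no λ ()
sv _ ≟V rv _ = no λ ()
sv _ ≟V cv _ = no λ ()

Lin : Set
Lin = List (ℤ × Var)

coeff : Lin → Var → ℤ
coeff [] v = + 0
coeff ((k , u) ∷ xs) v with u ≟V v
... | yes _ = k ℤ.+ coeff xs v
... | no _ = coeff xs v

scale : ℤ → Lin → Lin
scale z = map (λ p → (z ℤ.* proj₁ p , proj₂ p))

combine : List (ℤ × Lin) → Lin
combine = concatMap (λ p → scale (proj₁ p) (proj₂ p))

-- relators: r+c+s for (r,c,s) ∈ W, and a, b, d for the chosen (a,b,d)
relators : List Triple → Triple → List Lin
relators W (a , b , d) =
  map (λ t → (+ 1 , rv (proj₁ t)) ∷ (+ 1 , cv (proj₁ (proj₂ t))) ∷
             (+ 1 , sv (proj₂ (proj₂ t))) ∷ []) W ++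
  ((+ 1 , rv a) ∷ []) ∷ ((+ 1 , cv b) ∷ []) ∷ ((+ 1 , sv d) ∷ []) ∷ []

InSpan : List Lin → Lin → Set
InSpan rels x = Σ (List (ℤ × Lin)) λ ks →
  All (λ p → proj₂ p ∈ rels) ks × (∀ v → coeff x v ≡ coeff (combine ks) v)

InV : List Triple → Var → Set
InV W (rv r) = r ∈ rowsOf W
InV W (cv c) = c ∈ colsOf W
InV W (sv s) = s ∈ symsOf W

-- elements of the free abelian group on V
Elem : List Triple → Set
Elem W = Σ Lin (All (λ p → InV W (proj₂ p)))

-- equality in the group defined using triple t
Eq : (W : List Triple) → Triple → Elem W → Elem W → Set
Eq W t x y = InSpan (relators W t) (proj₁ x ++ scale (-[1+ 0 ]) (proj₁ y))

_⊕_ : {W : List Triple} → Elem W → Elem W → Elem W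
(x , px) ⊕ (y , py) = (x ++ y , ++⁺ px py)

rowDiff : (W : List Triple) (r r' : ℕ) → r ∈ rowsOf W → r' ∈ rowsOf W → Elem W
rowDiff W r r' p p' = ((+ 1 , rv r) ∷ (-[1+ 0 ] , rv r') ∷ []) , (p ∷ p' ∷ [])

IsIso : (W : List Triple) (t₁ t₀ : Triple) → (Elem W → Elem W) → Set
IsIso W t₁ t₀ f =
  (∀ x y → Eq W t₁ x y → Eq W t₀ (f x) (f y)) ×
  (∀ x y → Eq W t₀ (f (x ⊕ y)) (f x ⊕ f y)) ×
  (∀ x y → Eq W t₀ (f x) (f y) → Eq W t₁ x y) ×
  (∀ y → Σ (Elem W) λ x → Eq W t₀ (f x) y)

module Submission where

-- Every indeterminate has a sort (row, column or symbol), and a formal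
-- combination z has three weights: the sums of its row, column and symbol
-- coefficients.  For an anchor triple t = (a , b , d) put
--
--     anchor t z = wᵣ(z)·a + w_c(z)·b + wₛ(z)·d ,     θ t z = z − anchor t z .
--
-- θ t is linear, θ t z is balanced (all three weights vanish), θ t fixes
-- balanced combinations, and z − θ t z = anchor t z lies in the relator
-- span of t.  If u ∈ W then θ u sends every relator for u into the relator
-- span for t: a relator r+c+s goes to (r+c+s) − (a'+b'+d') and the anchor
-- indeterminates of u go to 0.  Hence θ t₁ induces a homomorphism from the
-- group anchored at t₁ to the group anchored at t₀, with inverse induced by
-- θ t₀, and it fixes the balanced elements r − r'.

open import Defs
open import Data.Nat using (ℕ)
open import Data.Product using (Σ; _×_)
open import Data.List using (List)
open import Data.List.Membership.Propositional using (_∈_)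

open import Data.Nat using (suc; _≤_; s≤s)
open import Data.Nat.Properties using (≤-refl; ≤-trans; ≤-reflexive; m≤n⇒m≤1+n)
open import Data.Integer using (ℤ; +_; -[1+_]; _+_; _*_; _-_)
import Data.Integer.Properties as ℤP
open import Data.Integer.Tactic.RingSolver using (solve-∀)
open import Data.Product using (_,_; proj₁; proj₂)
open import Data.Sum using (inj₁; inj₂)
open import Data.Empty using (⊥-elim)
open import Data.List using ([]; _∷_; _++_; map; length)
open import Data.List.Properties using (++-identityʳ; concatMap-++)
open import Data.List.Relation.Unary.All using (All; []; _∷_)
open import Data.List.Relation.Unary.All.Properties using (++⁺; map⁺)
open import Data.List.Relation.Unary.Any using (here; there)
open import Data.List.Membership.Propositional.Properties
  using (∈-map⁺; ∈-map⁻; ∈-++⁺ˡ; ∈-++⁺ʳ; ∈-++⁻)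
open import Relation.Nullary using (yes; no)
open import Relation.Binary using (Setoid)
import Relation.Binary.Reasoning.Setoid as SetoidReasoning
open import Relation.Binary.PropositionalEquality

variable
  x y z x' y' : Lin
  k : ℤ
  u : Var

-- Coefficient algebra of formal combinations

-- Equality in the free abelian group on the indeterminates: equal
-- coefficients.  A record, so that both sides are inferable from a proof.
infix 4 _≈_
record _≈_ (x y : Lin) : Set where
  constructor coeffwise
  field at : ∀ v → coeff x v ≡ coeff y v
open _≈_

≈-refl : x ≈ x
≈-refl .at v = refl

≈-reflexive : x ≡ y → x ≈ y
≈-reflexive refl = ≈-refl

≈-sym : x ≈ y → y ≈ x
≈-sym p .at v = sym (at p v)

≈-trans : x ≈ y → y ≈ z → x ≈ z
≈-trans p q .at v = trans (at p v) (at q v)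

δ : Var → Var → ℤ
δ u v with u ≟V v
... | yes _ = + 1
... | no _ = + 0

coeff-cons : ∀ k u xs v → coeff ((k , u) ∷ xs) v ≡ k * δ u v + coeff xs v
coeff-cons k u xs v with u ≟V v
... | yes _ = cong (_+ coeff xs v) (sym (ℤP.*-identityʳ k))
... | no _ = sym (trans (cong (_+ coeff xs v) (ℤP.*-zeroʳ k)) (ℤP.+-identityˡ _))

coeff-++ : ∀ xs ys v → coeff (xs ++ ys) v ≡ coeff xs v + coeff ys v
coeff-++ [] ys v = sym (ℤP.+-identityˡ _)
coeff-++ ((k , u) ∷ xs) ys v with u ≟V v
... | yes _ = trans (cong (_+_ k) (coeff-++ xs ys v)) (sym (ℤP.+-assoc k _ _))
... | no _ = coeff-++ xs ys v

coeff-scale : ∀ k xs v → coeff (scale k xs) v ≡ k * coeff xs v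
coeff-scale k [] v = sym (ℤP.*-zeroʳ k)
coeff-scale k ((l , u) ∷ xs) v with u ≟V v
... | yes _ = trans (cong (_+_ (k * l)) (coeff-scale k xs v)) (sym (ℤP.*-distribˡ-+ k l _))
... | no _ = coeff-scale k xs v

drop-zero : ((+ 0 , u) ∷ x) ≈ x
drop-zero {u} {x} .at v with u ≟V v
... | yes _ = ℤP.+-identityˡ (coeff x v)
... | no _ = refl

cons-cong : x ≈ y → ((k , u) ∷ x) ≈ ((k , u) ∷ y)
cons-cong {k = k} {u} p .at v with u ≟V v
... | yes _ = cong (_+_ k) (at p v)
... | no _ = at p v

++-cong : x ≈ x' → y ≈ y' → x ++ y ≈ x' ++ y'
++-cong {x} {x'} {y} {y'} p q .at v =
  trans (coeff-++ x y v) (trans (cong₂ _+_ (at p v) (at q v)) (sym (coeff-++ x' y' v)))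

scale-cong : ∀ k → x ≈ y → scale k x ≈ scale k y
scale-cong {x} {y} k p .at v =
  trans (coeff-scale k x v) (trans (cong (k *_) (at p v)) (sym (coeff-scale k y v)))

infixl 6 _⊖_
_⊖_ : Lin → Lin → Lin
x ⊖ y = x ++ scale -[1+ 0 ] y

coeff-⊖ : ∀ x y v → coeff (x ⊖ y) v ≡ coeff x v - coeff y v
coeff-⊖ x y v = trans (coeff-++ x _ v)
  (cong (_+_ (coeff x v)) (trans (coeff-scale -[1+ 0 ] y v) (ℤP.-1*i≡-i (coeff y v))))

⊖-cong : x ≈ x' → y ≈ y' → x ⊖ y ≈ x' ⊖ y'
⊖-cong p q = ++-cong p (scale-cong -[1+ 0 ] q)

≈⇒⊖≈[] : x ≈ y → x ⊖ y ≈ []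
≈⇒⊖≈[] {x} {y} p .at v = begin
  coeff (x ⊖ y) v         ≡⟨ coeff-⊖ x y v ⟩
  coeff x v - coeff y v   ≡⟨ cong (_- coeff y v) (at p v) ⟩
  coeff y v - coeff y v   ≡⟨ ℤP.+-inverseʳ (coeff y v) ⟩
  + 0                     ∎
  where open ≡-Reasoning

⊖-swap : ∀ x y → y ⊖ x ≈ scale -[1+ 0 ] (x ⊖ y)
⊖-swap x y .at v = begin
  coeff (y ⊖ x) v                  ≡⟨ coeff-⊖ y x v ⟩
  coeff y v - coeff x v            ≡⟨ ring (coeff x v) (coeff y v) ⟩
  -[1+ 0 ] * (coeff x v - coeff y v) ≡⟨ cong (-[1+ 0 ] *_) (sym (coeff-⊖ x y v)) ⟩
  -[1+ 0 ] * coeff (x ⊖ y) v       ≡⟨ sym (coeff-scale -[1+ 0 ] (x ⊖ y) v) ⟩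
  coeff (scale -[1+ 0 ] (x ⊖ y)) v ∎
  where
  open ≡-Reasoning
  ring : ∀ a b → b - a ≡ -[1+ 0 ] * (a - b)
  ring = solve-∀

⊖-split : ∀ x y z → x ⊖ z ≈ (x ⊖ y) ++ (y ⊖ z)
⊖-split x y z .at v = begin
  coeff (x ⊖ z) v                          ≡⟨ coeff-⊖ x z v ⟩
  coeff x v - coeff z v                    ≡⟨ ring (coeff x v) (coeff y v) (coeff z v) ⟩
  (coeff x v - coeff y v) + (coeff y v - coeff z v)
    ≡⟨ sym (cong₂ _+_ (coeff-⊖ x y v) (coeff-⊖ y z v)) ⟩
  coeff (x ⊖ y) v + coeff (y ⊖ z) v        ≡⟨ sym (coeff-++ (x ⊖ y) (y ⊖ z) v) ⟩
  coeff ((x ⊖ y) ++ (y ⊖ z)) v             ∎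
  where
  open ≡-Reasoning
  ring : ∀ a b c → a - c ≡ (a - b) + (b - c)
  ring = solve-∀

⊖-++ : ∀ x y p q → (x ++ y) ⊖ (p ++ q) ≈ (x ⊖ p) ++ (y ⊖ q)
⊖-++ x y p q .at v = begin
  coeff ((x ++ y) ⊖ (p ++ q)) v                     ≡⟨ coeff-⊖ (x ++ y) (p ++ q) v ⟩
  coeff (x ++ y) v - coeff (p ++ q) v               ≡⟨ cong₂ _-_ (coeff-++ x y v) (coeff-++ p q v) ⟩
  (coeff x v + coeff y v) - (coeff p v + coeff q v) ≡⟨ ring (coeff x v) (coeff y v) (coeff p v) (coeff q v) ⟩
  (coeff x v - coeff p v) + (coeff y v - coeff q v) ≡⟨ sym (cong₂ _+_ (coeff-⊖ x p v) (coeff-⊖ y q v)) ⟩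
  coeff (x ⊖ p) v + coeff (y ⊖ q) v                 ≡⟨ sym (coeff-++ (x ⊖ p) (y ⊖ q) v) ⟩
  coeff ((x ⊖ p) ++ (y ⊖ q)) v                      ∎
  where
  open ≡-Reasoning
  ring : ∀ a b c d → (a + b) - (c + d) ≡ (a - c) + (b - d)
  ring = solve-∀

⊖-scale : ∀ k x y → scale k x ⊖ scale k y ≈ scale k (x ⊖ y)
⊖-scale k x y .at v = begin
  coeff (scale k x ⊖ scale k y) v              ≡⟨ coeff-⊖ (scale k x) (scale k y) v ⟩
  coeff (scale k x) v - coeff (scale k y) v    ≡⟨ cong₂ _-_ (coeff-scale k x v) (coeff-scale k y v) ⟩
  k * coeff x v - k * coeff y v                ≡⟨ ring k (coeff x v) (coeff y v) ⟩
  k * (coeff x v - coeff y v)                  ≡⟨ cong (k *_) (sym (coeff-⊖ x y v)) ⟩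
  k * coeff (x ⊖ y) v                          ≡⟨ sym (coeff-scale k (x ⊖ y) v) ⟩
  coeff (scale k (x ⊖ y)) v                    ∎
  where
  open ≡-Reasoning
  ring : ∀ k a b → k * a - k * b ≡ k * (a - b)
  ring = solve-∀

⊖-⊖ : ∀ x y → x ⊖ (x ⊖ y) ≈ y
⊖-⊖ x y .at v = begin
  coeff (x ⊖ (x ⊖ y)) v               ≡⟨ coeff-⊖ x (x ⊖ y) v ⟩
  coeff x v - coeff (x ⊖ y) v         ≡⟨ cong (_-_ (coeff x v)) (coeff-⊖ x y v) ⟩
  coeff x v - (coeff x v - coeff y v) ≡⟨ ring (coeff x v) (coeff y v) ⟩
  coeff y v                           ∎
  where
  open ≡-Reasoning
  ring : ∀ a b → a - (a - b) ≡ b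
  ring = solve-∀

scale-zero : ∀ x → scale (+ 0) x ≈ []
scale-zero x .at v = coeff-scale (+ 0) x v

-- Spans of relators and the congruence they define

module Span (R : List Lin) where

  private
    rescale : ℤ → List (ℤ × Lin) → List (ℤ × Lin)
    rescale k = map (λ p → (k * proj₁ p , proj₂ p))

    coeff-rescale : ∀ k ks v → coeff (combine (rescale k ks)) v ≡ k * coeff (combine ks) v
    coeff-rescale k [] v = sym (ℤP.*-zeroʳ k)
    coeff-rescale k ((l , ρ) ∷ ks) v = begin
      coeff (scale (k * l) ρ ++ combine (rescale k ks)) v
        ≡⟨ coeff-++ (scale (k * l) ρ) _ v ⟩
      coeff (scale (k * l) ρ) v + coeff (combine (rescale k ks)) v
        ≡⟨ cong₂ _+_ (coeff-scale (k * l) ρ v) (coeff-rescale k ks v) ⟩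
      k * l * coeff ρ v + k * coeff (combine ks) v
        ≡⟨ ring k l (coeff ρ v) (coeff (combine ks) v) ⟩
      k * (l * coeff ρ v + coeff (combine ks) v)
        ≡⟨ cong (k *_) (sym (cong (_+ _) (coeff-scale l ρ v))) ⟩
      k * (coeff (scale l ρ) v + coeff (combine ks) v)
        ≡⟨ cong (k *_) (sym (coeff-++ (scale l ρ) (combine ks) v)) ⟩
      k * coeff (scale l ρ ++ combine ks) v ∎
      where
      open ≡-Reasoning
      ring : ∀ k l a b → k * l * a + k * b ≡ k * (l * a + b)
      ring = solve-∀

  span-resp : x ≈ y → InSpan R y → InSpan R x
  span-resp p (ks , w , q) = ks , w , λ v → trans (at p v) (q v)

  span-[] : InSpan R []
  span-[] = [] , [] , λ v → refl

  span-++ : ∀ x y → InSpan R x → InSpan R y → InSpan R (x ++ y)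
  span-++ x y (ks , w , p) (ks' , w' , p') = ks ++ ks' , ++⁺ w w' , λ v → begin
    coeff (x ++ y) v                            ≡⟨ coeff-++ x y v ⟩
    coeff x v + coeff y v                       ≡⟨ cong₂ _+_ (p v) (p' v) ⟩
    coeff (combine ks) v + coeff (combine ks') v ≡⟨ sym (coeff-++ (combine ks) _ v) ⟩
    coeff (combine ks ++ combine ks') v         ≡⟨ cong (λ c → coeff c v) (sym (concatMap-++ _ ks ks')) ⟩
    coeff (combine (ks ++ ks')) v               ∎
    where open ≡-Reasoning

  span-scale : ∀ k x → InSpan R x → InSpan R (scale k x)
  span-scale k x (ks , w , p) = rescale k ks , map⁺ w ,
    λ v → trans (coeff-scale k x v) (trans (cong (k *_) (p v)) (sym (coeff-rescale k ks v)))

  span-gen : ∀ {ρ} → ρ ∈ R → InSpan R ρ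
  span-gen {ρ} m = (+ 1 , ρ) ∷ [] , m ∷ [] , λ v → sym (begin
    coeff (scale (+ 1) ρ ++ []) v ≡⟨ cong (λ c → coeff c v) (++-identityʳ (scale (+ 1) ρ)) ⟩
    coeff (scale (+ 1) ρ) v       ≡⟨ coeff-scale (+ 1) ρ v ⟩
    + 1 * coeff ρ v               ≡⟨ ℤP.*-identityˡ (coeff ρ v) ⟩
    coeff ρ v                     ∎)
    where open ≡-Reasoning

  -- Congruence modulo ⟨R⟩; on elements of the group this is exactly Eq.
  infix 4 _∼_
  _∼_ : Lin → Lin → Set
  x ∼ y = InSpan R (x ⊖ y)

  ≈⇒∼ : x ≈ y → x ∼ y
  ≈⇒∼ p = span-resp (≈⇒⊖≈[] p) span-[]

  ∼-sym : ∀ x y → x ∼ y → y ∼ x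
  ∼-sym x y p = span-resp (⊖-swap x y) (span-scale -[1+ 0 ] (x ⊖ y) p)

  ∼-trans : ∀ x y z → x ∼ y → y ∼ z → x ∼ z
  ∼-trans x y z p q = span-resp (⊖-split x y z) (span-++ (x ⊖ y) (y ⊖ z) p q)

  ∼-setoid : Setoid _ _
  ∼-setoid = record
    { Carrier = Lin
    ; _≈_ = _∼_
    ; isEquivalence = record
      { refl = λ {x} → ≈⇒∼ (≈-refl {x})
      ; sym = λ {x} {y} → ∼-sym x y
      ; trans = λ {x} {y} {z} → ∼-trans x y z
      }
    }

record Linear (h : Lin → Lin) : Set where
  field
    ≈-cong : x ≈ y → h x ≈ h y
    additive : ∀ x y → h (x ++ y) ≈ h x ++ h y
    homogeneous : ∀ k x → h (scale k x) ≈ scale k (h x)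

  preserves-⊖ : ∀ x y → h (x ⊖ y) ≈ h x ⊖ h y
  preserves-⊖ x y = ≈-trans (additive x _) (++-cong ≈-refl (homogeneous -[1+ 0 ] y))

  preserves-[] : h [] ≈ []
  preserves-[] = ≈-trans (homogeneous (+ 0) []) (scale-zero (h []))

span-map : ∀ {R S h} → Linear h → (∀ {ρ} → ρ ∈ R → InSpan S (h ρ)) →
  ∀ x → InSpan R x → InSpan S (h x)
span-map {R} {S} {h} lin gen x (ks , w , p) =
  span-resp (≈-cong (coeffwise p)) (on-combination ks w)
  where
  open Linear lin
  open Span S
  on-combination : ∀ ks → All (λ q → proj₂ q ∈ R) ks → InSpan S (h (combine ks))
  on-combination [] [] = span-resp preserves-[] span-[]
  on-combination ((k , ρ) ∷ ks) (m ∷ w) =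
    span-resp (≈-trans (additive (scale k ρ) _) (++-cong (homogeneous k ρ) ≈-refl))
      (span-++ (scale k (h ρ)) (h (combine ks)) (span-scale k (h ρ) (gen m)) (on-combination ks w))

-- Weights

ev : (Var → ℤ) → Lin → ℤ
ev w [] = + 0
ev w ((k , u) ∷ xs) = k * w u + ev w xs

ev-++ : ∀ w xs ys → ev w (xs ++ ys) ≡ ev w xs + ev w ys
ev-++ w [] ys = sym (ℤP.+-identityˡ _)
ev-++ w ((k , u) ∷ xs) ys =
  trans (cong (_+_ (k * w u)) (ev-++ w xs ys)) (sym (ℤP.+-assoc (k * w u) _ _))

ev-scale : ∀ w k xs → ev w (scale k xs) ≡ k * ev w xs
ev-scale w k [] = sym (ℤP.*-zeroʳ k)
ev-scale w k ((l , u) ∷ xs) = begin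
  k * l * w u + ev w (scale k xs) ≡⟨ cong (_+_ (k * l * w u)) (ev-scale w k xs) ⟩
  k * l * w u + k * ev w xs       ≡⟨ ring k l (w u) (ev w xs) ⟩
  k * (l * w u + ev w xs)         ∎
  where
  open ≡-Reasoning
  ring : ∀ k l a b → k * l * a + k * b ≡ k * (l * a + b)
  ring = solve-∀

ev-⊖ : ∀ w x y → ev w (x ⊖ y) ≡ ev w x - ev w y
ev-⊖ w x y = trans (ev-++ w x _)
  (cong (_+_ (ev w x)) (trans (ev-scale w -[1+ 0 ] y) (ℤP.-1*i≡-i (ev w y))))

-- Removing all terms on one indeterminate, to show that ev only depends on
-- coefficients (the list may mention an indeterminate several times).
without : Var → Lin → Lin
without u [] = []
without u ((k , u') ∷ xs) with u' ≟V u
... | yes _ = without u xs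
... | no _ = (k , u') ∷ without u xs

ev-without : ∀ w u xs → ev w xs ≡ w u * coeff xs u + ev w (without u xs)
ev-without w u [] = sym (cong (_+ + 0) (ℤP.*-zeroʳ (w u)))
ev-without w u ((k , u') ∷ xs) with u' ≟V u
... | yes refl = trans (cong (_+_ (k * w u)) (ev-without w u xs))
                   (ring k (w u) (coeff xs u) (ev w (without u xs)))
  where
  ring : ∀ k a c e → k * a + (a * c + e) ≡ a * (k + c) + e
  ring = solve-∀
... | no _ = trans (cong (_+_ (k * w u')) (ev-without w u xs))
               (ring k (w u') (w u) (coeff xs u) (ev w (without u xs)))
  where
  ring : ∀ k a' a c e → k * a' + (a * c + e) ≡ a * c + (k * a' + e)
  ring = solve-∀

coeff-without-same : ∀ u xs → coeff (without u xs) u ≡ + 0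
coeff-without-same u [] = refl
coeff-without-same u ((k , u') ∷ xs) with u' ≟V u
... | yes _ = coeff-without-same u xs
... | no u'≢u with u' ≟V u
...   | yes u'≡u = ⊥-elim (u'≢u u'≡u)
...   | no _ = coeff-without-same u xs

coeff-without-other : ∀ u v xs → u ≢ v → coeff (without u xs) v ≡ coeff xs v
coeff-without-other u v [] _ = refl
coeff-without-other u v ((k , u') ∷ xs) u≢v with u' ≟V u
... | no _ = trans (coeff-cons k u' (without u xs) v)
               (trans (cong (_+_ (k * δ u' v)) (coeff-without-other u v xs u≢v))
                 (sym (coeff-cons k u' xs v)))
... | yes refl with u ≟V v
...   | yes u≡v = ⊥-elim (u≢v u≡v)
...   | no _ = coeff-without-other u v xs u≢v

without-head : ∀ k u xs → without u ((k , u) ∷ xs) ≡ without u xs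
without-head k u xs with u ≟V u
... | yes _ = refl
... | no u≢u = ⊥-elim (u≢u refl)

length-without : ∀ u xs → length (without u xs) ≤ length xs
length-without u [] = ≤-refl
length-without u ((k , u') ∷ xs) with u' ≟V u
... | yes _ = m≤n⇒m≤1+n (length-without u xs)
... | no _ = s≤s (length-without u xs)

ev-null : ∀ w n xs → length xs ≤ n → xs ≈ [] → ev w xs ≡ + 0
ev-null w n [] _ _ = refl
ev-null w (suc n) ((k , u) ∷ xs) (s≤s len) null = begin
  ev w ((k , u) ∷ xs)                                ≡⟨ ev-without w u ((k , u) ∷ xs) ⟩
  w u * coeff ((k , u) ∷ xs) u + ev w rest           ≡⟨ cong₂ (λ c e → w u * c + e) (at null u) rest-ev ⟩
  w u * + 0 + + 0                                    ≡⟨ trans (ℤP.+-identityʳ _) (ℤP.*-zeroʳ (w u)) ⟩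
  + 0                                                ∎
  where
  open ≡-Reasoning
  rest : Lin
  rest = without u ((k , u) ∷ xs)
  shorter : length rest ≤ n
  shorter = ≤-trans (≤-reflexive (cong length (without-head k u xs))) (≤-trans (length-without u xs) len)
  rest-null : rest ≈ []
  rest-null .at v with u ≟V v
  ... | yes refl = coeff-without-same u ((k , u) ∷ xs)
  ... | no u≢v = trans (coeff-without-other u v ((k , u) ∷ xs) u≢v) (at null v)
  rest-ev : ev w rest ≡ + 0
  rest-ev = ev-null w n rest shorter rest-null

ev-resp : ∀ w → x ≈ y → ev w x ≡ ev w y
ev-resp {x} {y} w p = ℤP.i-j≡0⇒i≡j _ _ (begin
  ev w x - ev w y ≡⟨ sym (ev-⊖ w x y) ⟩
  ev w (x ⊖ y)    ≡⟨ ev-null w _ (x ⊖ y) ≤-refl (≈⇒⊖≈[] p) ⟩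
  + 0             ∎)
  where open ≡-Reasoning

data Sort : Set where
  row col symbol : Sort

isSort : Sort → Var → ℤ
isSort row (rv _) = + 1
isSort col (cv _) = + 1
isSort symbol (sv _) = + 1
isSort _ _ = + 0

weight : Sort → Lin → ℤ
weight s = ev (isSort s)

Balanced : Lin → Set
Balanced z = ∀ s → weight s z ≡ + 0

-- The anchor map and θ

atoms : Triple → ℤ → ℤ → ℤ → Lin
atoms t k l m = (k , rv (proj₁ t)) ∷ (l , cv (proj₁ (proj₂ t))) ∷ (m , sv (proj₂ (proj₂ t))) ∷ []

atoms-cong : ∀ t {k l m k' l' m'} → k ≡ k' → l ≡ l' → m ≡ m' → atoms t k l m ≡ atoms t k' l' m'
atoms-cong t refl refl refl = refl

coeff-atoms : ∀ t k l m v → coeff (atoms t k l m) v ≡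
  k * δ (rv (proj₁ t)) v + (l * δ (cv (proj₁ (proj₂ t))) v + (m * δ (sv (proj₂ (proj₂ t))) v + + 0))
coeff-atoms t k l m v =
  trans (coeff-cons k _ _ v) (cong (_+_ (k * _)) (trans (coeff-cons l _ _ v) (cong (_+_ (l * _)) (coeff-cons m _ _ v))))

atoms-++ : ∀ t k l m k' l' m' → atoms t k l m ++ atoms t k' l' m' ≈ atoms t (k + k') (l + l') (m + m')
atoms-++ t k l m k' l' m' .at v = begin
  coeff (atoms t k l m ++ atoms t k' l' m') v
    ≡⟨ coeff-++ (atoms t k l m) _ v ⟩
  coeff (atoms t k l m) v + coeff (atoms t k' l' m') v
    ≡⟨ cong₂ _+_ (coeff-atoms t k l m v) (coeff-atoms t k' l' m' v) ⟩
  (k * α + (l * β + (m * γ + + 0))) + (k' * α + (l' * β + (m' * γ + + 0)))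
    ≡⟨ ring k l m k' l' m' α β γ ⟩
  (k + k') * α + ((l + l') * β + ((m + m') * γ + + 0))
    ≡⟨ sym (coeff-atoms t (k + k') (l + l') (m + m') v) ⟩
  coeff (atoms t (k + k') (l + l') (m + m')) v ∎
  where
  open ≡-Reasoning
  α β γ : ℤ
  α = δ (rv (proj₁ t)) v
  β = δ (cv (proj₁ (proj₂ t))) v
  γ = δ (sv (proj₂ (proj₂ t))) v
  ring : ∀ k l m k' l' m' α β γ →
    (k * α + (l * β + (m * γ + + 0))) + (k' * α + (l' * β + (m' * γ + + 0)))
      ≡ (k + k') * α + ((l + l') * β + ((m + m') * γ + + 0))
  ring = solve-∀

atoms-zero : ∀ t → atoms t (+ 0) (+ 0) (+ 0) ≈ []
atoms-zero t = ≈-trans drop-zero (≈-trans drop-zero drop-zero)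

unitR unitC unitS : Triple → Lin
unitR t = (+ 1 , rv (proj₁ t)) ∷ []
unitC t = (+ 1 , cv (proj₁ (proj₂ t))) ∷ []
unitS t = (+ 1 , sv (proj₂ (proj₂ t))) ∷ []

relator : Triple → Lin
relator t = atoms t (+ 1) (+ 1) (+ 1)

atoms-units : ∀ t k l m → atoms t k l m ≈ scale k (unitR t) ++ (scale l (unitC t) ++ scale m (unitS t))
atoms-units t k l m .at v = begin
  coeff (atoms t k l m) v
    ≡⟨ coeff-atoms t k l m v ⟩
  k * α + (l * β + (m * γ + + 0))
    ≡⟨ ring k l m α β γ ⟩
  k * (+ 1 * α + + 0) + ((l * (+ 1 * β + + 0)) + (m * (+ 1 * γ + + 0)))
    ≡⟨ sym (cong₂ _+_ (unit k (rv (proj₁ t))) (cong₂ _+_ (unit l (cv (proj₁ (proj₂ t)))) (unit m (sv (proj₂ (proj₂ t)))))) ⟩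
  coeff (scale k (unitR t)) v + (coeff (scale l (unitC t)) v + coeff (scale m (unitS t)) v)
    ≡⟨ sym (trans (coeff-++ (scale k (unitR t)) (scale l (unitC t) ++ scale m (unitS t)) v)
                 (cong (_+_ (coeff (scale k (unitR t)) v)) (coeff-++ (scale l (unitC t)) (scale m (unitS t)) v))) ⟩
  coeff (scale k (unitR t) ++ (scale l (unitC t) ++ scale m (unitS t))) v ∎
  where
  open ≡-Reasoning
  α β γ : ℤ
  α = δ (rv (proj₁ t)) v
  β = δ (cv (proj₁ (proj₂ t))) v
  γ = δ (sv (proj₂ (proj₂ t))) v
  unit : ∀ k u → coeff (scale k ((+ 1 , u) ∷ [])) v ≡ k * (+ 1 * δ u v + + 0)
  unit k u = trans (coeff-scale k ((+ 1 , u) ∷ []) v) (cong (k *_) (coeff-cons (+ 1) u [] v))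
  ring : ∀ k l m α β γ → k * α + (l * β + (m * γ + + 0))
    ≡ k * (+ 1 * α + + 0) + ((l * (+ 1 * β + + 0)) + (m * (+ 1 * γ + + 0)))
  ring = solve-∀

select : Sort → ℤ → ℤ → ℤ → ℤ
select row k l m = k
select col k l m = l
select symbol k l m = m

weight-atoms : ∀ s t k l m → weight s (atoms t k l m) ≡ select s k l m
weight-atoms row t k l m = ring k l m
  where
  ring : ∀ k l m → k * + 1 + (l * + 0 + (m * + 0 + + 0)) ≡ k
  ring = solve-∀
weight-atoms col t k l m = ring k l m
  where
  ring : ∀ k l m → k * + 0 + (l * + 1 + (m * + 0 + + 0)) ≡ l
  ring = solve-∀
weight-atoms symbol t k l m = ring k l m
  where
  ring : ∀ k l m → k * + 0 + (l * + 0 + (m * + 1 + + 0)) ≡ m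
  ring = solve-∀

anchor : Triple → Lin → Lin
anchor t z = atoms t (weight row z) (weight col z) (weight symbol z)

weight-anchor : ∀ s t z → weight s (anchor t z) ≡ weight s z
weight-anchor s t z = trans (weight-atoms s t (weight row z) (weight col z) (weight symbol z)) (select-weights s)
  where
  select-weights : ∀ s → select s (weight row z) (weight col z) (weight symbol z) ≡ weight s z
  select-weights row = refl
  select-weights col = refl
  select-weights symbol = refl

anchor-balanced : ∀ t z → Balanced z → anchor t z ≈ []
anchor-balanced t z bal =
  ≈-trans (≈-reflexive (atoms-cong t (bal row) (bal col) (bal symbol))) (atoms-zero t)

θ : Triple → Lin → Lin
θ t z = z ⊖ anchor t z

θ-linear : ∀ t → Linear (θ t)
θ-linear t = record { ≈-cong = θ-cong ; additive = additive ; homogeneous = homogeneous }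
  where
  θ-cong : x ≈ y → θ t x ≈ θ t y
  θ-cong p = ⊖-cong p (≈-reflexive
    (atoms-cong t (ev-resp (isSort row) p) (ev-resp (isSort col) p) (ev-resp (isSort symbol) p)))
  additive : ∀ x y → θ t (x ++ y) ≈ θ t x ++ θ t y
  additive x y = ≈-trans
    (⊖-cong ≈-refl (≈-trans
      (≈-reflexive (atoms-cong t (ev-++ _ x y) (ev-++ _ x y) (ev-++ _ x y)))
      (≈-sym (atoms-++ t _ _ _ _ _ _))))
    (⊖-++ x y (anchor t x) (anchor t y))
  homogeneous : ∀ k x → θ t (scale k x) ≈ scale k (θ t x)
  homogeneous k x = ≈-trans
    (⊖-cong ≈-refl
      (≈-reflexive (atoms-cong t (ev-scale _ k x) (ev-scale _ k x) (ev-scale _ k x))))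
    (⊖-scale k x (anchor t x))

θ-balanced : ∀ t z → Balanced (θ t z)
θ-balanced t z s = begin
  weight s (z ⊖ anchor t z)               ≡⟨ ev-⊖ (isSort s) z (anchor t z) ⟩
  weight s z - weight s (anchor t z)      ≡⟨ cong (_-_ (weight s z)) (weight-anchor s t z) ⟩
  weight s z - weight s z                 ≡⟨ ℤP.+-inverseʳ (weight s z) ⟩
  + 0                                     ∎
  where open ≡-Reasoning

θ-fixes : ∀ t z → Balanced z → θ t z ≈ z
θ-fixes t z bal =
  ≈-trans (⊖-cong ≈-refl (anchor-balanced t z bal)) (≈-reflexive (++-identityʳ z))

θ-kills : ∀ t e → anchor t e ≈ e → θ t e ≈ []
θ-kills t e p = ≈⇒⊖≈[] (≈-sym p)

-- θ u (r + c + s) = (r + c + s) − (a' + b' + d') for u = (a' , b' , d'),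
-- since a relator has all three weights equal to 1.
θ-relator-of : ∀ u T → θ u (relator T) ≡ relator T ⊖ relator u
θ-relator-of u T = refl

-- Relators for an anchor t

module _ (W : List Triple) (t : Triple) where
  open Span (relators W t)

  unitR∈ : unitR t ∈ relators W t
  unitR∈ = ∈-++⁺ʳ (map relator W) (here refl)

  unitC∈ : unitC t ∈ relators W t
  unitC∈ = ∈-++⁺ʳ (map relator W) (there (here refl))

  unitS∈ : unitS t ∈ relators W t
  unitS∈ = ∈-++⁺ʳ (map relator W) (there (there (here refl)))

  anchor-span : ∀ z → InSpan (relators W t) (anchor t z)
  anchor-span z = span-resp (atoms-units t kᵣ k꜀ kₛ)
    (span-++ (scale kᵣ (unitR t)) (scale k꜀ (unitC t) ++ scale kₛ (unitS t))
      (span-scale kᵣ (unitR t) (span-gen unitR∈))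
      (span-++ (scale k꜀ (unitC t)) (scale kₛ (unitS t))
        (span-scale k꜀ (unitC t) (span-gen unitC∈)) (span-scale kₛ (unitS t) (span-gen unitS∈))))
    where
    kᵣ k꜀ kₛ : ℤ
    kᵣ = weight row z
    k꜀ = weight col z
    kₛ = weight symbol z

  ∼-θ : ∀ z → z ∼ θ t z
  ∼-θ z = span-resp (⊖-⊖ z (anchor t z)) (anchor-span z)

  θ-relator : ∀ u → u ∈ W → ∀ {ρ} → ρ ∈ relators W u → InSpan (relators W t) (θ u ρ)
  θ-relator u u∈W m with ∈-++⁻ (map relator W) m
  ... | inj₁ m' with ∈-map⁻ relator m'
  ...   | T , T∈W , refl = span-resp (≈-reflexive (θ-relator-of u T))
    (span-++ (relator T) (scale -[1+ 0 ] (relator u)) (span-gen (∈-++⁺ˡ (∈-map⁺ relator T∈W)))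
       (span-scale -[1+ 0 ] (relator u) (span-gen (∈-++⁺ˡ (∈-map⁺ relator u∈W)))))
  θ-relator u u∈W m | inj₂ (here refl) =
    span-resp (θ-kills u (unitR u) (cons-cong (≈-trans drop-zero drop-zero))) span-[]
  θ-relator u u∈W m | inj₂ (there (here refl)) =
    span-resp (θ-kills u (unitC u) (≈-trans drop-zero (cons-cong drop-zero))) span-[]
  θ-relator u u∈W m | inj₂ (there (there (here refl))) =
    span-resp (θ-kills u (unitS u) (≈-trans drop-zero drop-zero)) span-[]

  transfer : ∀ u → u ∈ W → ∀ x y → Span._∼_ (relators W u) x y → θ u x ∼ θ u y
  transfer u u∈W x y p = span-resp (≈-sym (Linear.preserves-⊖ (θ-linear u) x y))
    (span-map (θ-linear u) (θ-relator u u∈W) (x ⊖ y) p)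

anchor-in-V : ∀ {W} u → u ∈ W → ∀ z → All (λ p → InV W (proj₂ p)) (scale -[1+ 0 ] (anchor u z))
anchor-in-V u u∈W z = ∈-map⁺ proj₁ u∈W ∷ ∈-map⁺ (λ t → proj₁ (proj₂ t)) u∈W
                     ∷ ∈-map⁺ (λ t → proj₂ (proj₂ t)) u∈W ∷ []

θᴱ : ∀ {W} u → u ∈ W → Elem W → Elem W
θᴱ u u∈W x = θ u (proj₁ x) , ++⁺ (proj₂ x) (anchor-in-V u u∈W (proj₁ x))

difference-balanced : ∀ r r' → Balanced ((+ 1 , rv r) ∷ (-[1+ 0 ] , rv r') ∷ [])
difference-balanced r r' row = refl
difference-balanced r r' col = refl
difference-balanced r r' symbol = refl

corollary4p2 : (W B : List Triple) → IsBitrade W B → Spherical W B →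
    (t₀ t₁ : Triple) → t₀ ∈ W → t₁ ∈ W →
    Σ (Elem W → Elem W) λ f → IsIso W t₁ t₀ f ×
      (∀ (r r' : ℕ) (p : r ∈ rowsOf W) (p' : r' ∈ rowsOf W) →
        Eq W t₀ (f (rowDiff W r r' p p')) (rowDiff W r r' p p'))
corollary4p2 W B _ _ t₀ t₁ t₀∈W t₁∈W = f , (hom , add , inj , surj) , rows
  where
  module A₀ = Span (relators W t₀)
  module A₁ = Span (relators W t₁)
  f : Elem W → Elem W
  f = θᴱ t₁ t₁∈W

  hom : ∀ x y → Eq W t₁ x y → Eq W t₀ (f x) (f y)
  hom x y = transfer W t₀ t₁ t₁∈W (proj₁ x) (proj₁ y)

  add : ∀ x y → Eq W t₀ (f (x ⊕ y)) (f x ⊕ f y)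
  add x y = A₀.≈⇒∼ (Linear.additive (θ-linear t₁) (proj₁ x) (proj₁ y))

  -- θ t₀ undoes θ t₁ modulo the relators of t₁.
  inj : ∀ x y → Eq W t₀ (f x) (f y) → Eq W t₁ x y
  inj (x , _) (y , _) e = begin
    x                 ≈⟨ ∼-θ W t₁ x ⟩
    θ t₁ x            ≈⟨ A₁.≈⇒∼ (≈-sym (θ-fixes t₀ (θ t₁ x) (θ-balanced t₁ x))) ⟩
    θ t₀ (θ t₁ x)     ≈⟨ transfer W t₁ t₀ t₀∈W (θ t₁ x) (θ t₁ y) e ⟩
    θ t₀ (θ t₁ y)     ≈⟨ A₁.≈⇒∼ (θ-fixes t₀ (θ t₁ y) (θ-balanced t₁ y)) ⟩
    θ t₁ y            ≈⟨ A₁.∼-sym y (θ t₁ y) (∼-θ W t₁ y) ⟩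
    y                 ∎
    where open SetoidReasoning A₁.∼-setoid

  -- θ t₀ y is a preimage: θ t₁ fixes it, and it is congruent to y.
  surj : ∀ y → Σ (Elem W) λ x → Eq W t₀ (f x) y
  surj (y , y∈V) = θᴱ t₀ t₀∈W (y , y∈V) ,
    A₀.∼-trans (θ t₁ (θ t₀ y)) (θ t₀ y) y (A₀.≈⇒∼ (θ-fixes t₁ (θ t₀ y) (θ-balanced t₀ y)))
      (A₀.∼-sym y (θ t₀ y) (∼-θ W t₀ y))

  rows : ∀ (r r' : ℕ) (p : r ∈ rowsOf W) (p' : r' ∈ rowsOf W) →
    Eq W t₀ (f (rowDiff W r r' p p')) (rowDiff W r r' p p')
  rows r r' p p' = A₀.≈⇒∼ (θ-fixes t₁ (proj₁ (rowDiff W r r' p p')) (difference-balanced r r'))
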